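{- Let $n\ge 1$ and let $G$ be a graph of order $2^n$ with maximum degree $\Delta(G)$. Then \[\operatorname{dil}(G,Q_n)\geq\max\left\{k\in\mathbb{Z}_{>0}\,:\,\sum_{i=1}^{k-1}\binom{n}{i}<\Delta(G)\right\}.\]
   Context: $Q_n$ is the $n$-dimensional hypercube: vertex set $\{0,1\}^n$, two vertices adjacent iff they differ in exactly one coordinate. An embedding of a graph $G$ into a graph $H$ is a pair $(f,P_f)$ where $f:V(G)\to V(H)$ is injective and $P_f$ assigns to each edge $uv\in E(G)$ a path in $H$ between $f(u)$ and $f(v)$. The dilation of the embedding is the maximum length of $P_f(e)$ over $e\in E(G)$, and $\operatorname{dil}(G,H)$ is the minimum dilation over all embeddings of $G$ into $H$. -}

module Defs where

open import Data.Nat using (ℕ; zero; suc; _+_; _⊔_; _<_; _≤_)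
open import Data.Nat.Combinatorics using (_C_)
open import Data.Bool using (Bool)
open import Data.Fin using (Fin)
open import Data.Vec using (Vec; lookup)
open import Data.List using (List; []; _∷_; length; filter; allFin; map; foldr; concatMap)
open import Data.List.Relation.Unary.Unique.Propositional using (Unique)
open import Data.Product using (Σ; _×_; _,_; proj₁)
open import Relation.Nullary using (¬_; Dec; yes; no)
open import Relation.Binary.PropositionalEquality using (_≡_; _≢_)
open import Function.Definitions using (Injective)

record Graph (N : ℕ) : Set₁ where
  field
    Adj     : Fin N → Fin N → Set
    adj?    : ∀ u v → Dec (Adj u v)
    sym     : ∀ {u v} → Adj u v → Adj v u
    irrefl  : ∀ {u} → ¬ Adj u u

module _ {N : ℕ} (G : Graph N) where
  open Graph G

  degree : Fin N → ℕ
  degree v = length (filter (adj? v) (allFin N))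

  maxDegree : ℕ
  maxDegree = foldr _⊔_ 0 (map degree (allFin N))

QVertex : ℕ → Set
QVertex n = Vec Bool n

QAdj : ∀ {n} → QVertex n → QVertex n → Set
QAdj {n} x y = Σ (Fin n) λ i →
  (lookup x i ≢ lookup y i) × (∀ j → j ≢ i → lookup x j ≡ lookup y j)

data Walk {n : ℕ} : QVertex n → QVertex n → ℕ → Set where
  [_]  : (x : QVertex n) → Walk x x zero
  _∷_  : ∀ {x y z ℓ} → QAdj x y → Walk y z ℓ → Walk x z (suc ℓ)

walkVertices : ∀ {n} {x y : QVertex n} {ℓ} → Walk x y ℓ → List (QVertex n)
walkVertices [ x ] = x ∷ []
walkVertices (_∷_ {x = x} _ w) = x ∷ walkVertices w

Path : ∀ {n} → QVertex n → QVertex n → ℕ → Set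
Path x y ℓ = Σ (Walk x y ℓ) λ w → Unique (walkVertices w)

-- An embedding (f, P_f) of G into Q_n: an injective vertex map together
-- with, for every edge uv of G, a path in Q_n from f u to f v
-- (given here for each ordered adjacent pair).
record Embedding {N : ℕ} (G : Graph N) (n : ℕ) : Set where
  open Graph G
  field
    f     : Fin N → QVertex n
    f-inj : Injective _≡_ _≡_ f
    P     : ∀ u v → Adj u v → Σ ℕ λ ℓ → Path (f u) (f v) ℓ

  pathLength : ∀ u v → Adj u v → ℕ
  pathLength u v e = proj₁ (P u v e)

  pairLength : Fin N → Fin N → ℕ
  pairLength u v with adj? u v
  ... | yes e = pathLength u v e
  ... | no _  = 0

  dilation : ℕ
  dilation = foldr _⊔_ 0
    (concatMap (λ u → map (pairLength u) (allFin N)) (allFin N))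

binomSum : ℕ → ℕ → ℕ
binomSum n zero    = 0
binomSum n (suc m) = binomSum n m + n C suc m

-- "dil(G,Q_n) ≥ k": every embedding of G into Q_n has dilation ≥ k
-- (dil(G,Q_n) is the minimum dilation over all embeddings).
DilAtLeast : ∀ {N} → Graph N → ℕ → ℕ → Set
DilAtLeast G n k = (e : Embedding G n) → k ≤ Embedding.dilation e

-- A path of length ℓ in Q_n changes at most ℓ coordinates, so under an embedding
-- of dilation at most m the Δ(G) neighbours of a vertex v of maximum degree are
-- sent injectively to vertices at Hamming distance between 1 and m from f(v).
-- There are only Σ_{i=1}^{m} C(n,i) such vertices, hence Δ(G) ≤ Σ_{i=1}^{m} C(n,i).
module Submission where

open import Defs
open import Data.Nat using (ℕ; _^_; _≤_; _<_; _∸_)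
open import Data.Nat.Base using (zero; suc; _+_; _⊔_; z≤n; s≤s; s≤s⁻¹)
open import Data.Nat.Properties
open import Algebra.Properties.CommutativeSemigroup +-commutativeSemigroup using (interchange)
open import Data.Nat.Combinatorics using (_C_; nCk+nC[k+1]≡[n+1]C[k+1])
open import Data.Bool using (Bool; true; false; not)
open import Data.Fin as Fin using (Fin)
open import Data.Vec using (Vec; []; _∷_; lookup; tabulate)
open import Data.Vec.Properties using (tabulate∘lookup; tabulate-cong)
open import Data.List using (List; []; _∷_; length; filter; allFin; map; foldr; _++_)
open import Data.List.Properties using (length-map; length-++; length-removeAt′; foldr-preservesᵒ)
open import Data.List.Relation.Unary.Any as Any using (Any; here; there; _─_)
open import Data.List.Relation.Unary.Any.Properties using (map⁻)
import Data.List.Relation.Unary.All as All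
open import Data.List.Relation.Unary.AllPairs using (_∷_)
open import Data.List.Relation.Unary.Unique.Propositional using (Unique)
import Data.List.Relation.Unary.Unique.Propositional.Properties as Unique
open import Data.List.Relation.Binary.Subset.Propositional using (_⊆_)
open import Data.List.Membership.Propositional using (_∈_)
open import Data.List.Membership.Propositional.Properties
  using (∈-map⁺; ∈-map⁻; ∈-++⁺ˡ; ∈-++⁺ʳ; ∈-filter⁻; ∈-allFin; ∈-concat⁺′; foldr-selective)
open import Data.Product using (∃; _,_; proj₁; proj₂)
open import Data.Sum using (_⊎_; inj₁; inj₂)
open import Relation.Nullary using (yes; no; contradiction)
open import Relation.Binary.PropositionalEquality hiding ([_])

bitDistance : Bool → Bool → ℕ
bitDistance false false = 0
bitDistance true  true  = 0
bitDistance false true  = 1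
bitDistance true  false = 1

bitDistance-self : ∀ a → bitDistance a a ≡ 0
bitDistance-self false = refl
bitDistance-self true  = refl

bitDistance≤1 : ∀ a b → bitDistance a b ≤ 1
bitDistance≤1 false false = z≤n
bitDistance≤1 false true  = ≤-refl
bitDistance≤1 true  false = ≤-refl
bitDistance≤1 true  true  = z≤n

bitDistance-triangle : ∀ a b c → bitDistance a c ≤ bitDistance a b + bitDistance b c
bitDistance-triangle false false false = z≤n
bitDistance-triangle false false true  = ≤-refl
bitDistance-triangle false true  false = z≤n
bitDistance-triangle false true  true  = ≤-refl
bitDistance-triangle true  false false = ≤-refl
bitDistance-triangle true  false true  = z≤n
bitDistance-triangle true  true  false = ≤-refl
bitDistance-triangle true  true  true  = z≤n

bitDistance≡0⇒≡ : ∀ a b → bitDistance a b ≡ 0 → a ≡ b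
bitDistance≡0⇒≡ false false _ = refl
bitDistance≡0⇒≡ true  true  _ = refl

hamming : ∀ {n} → Vec Bool n → Vec Bool n → ℕ
hamming []      []      = 0
hamming (a ∷ x) (b ∷ y) = bitDistance a b + hamming x y

hamming-self : ∀ {n} (x : Vec Bool n) → hamming x x ≡ 0
hamming-self []      = refl
hamming-self (a ∷ x) = cong₂ _+_ (bitDistance-self a) (hamming-self x)

hamming≡0⇒≡ : ∀ {n} (x y : Vec Bool n) → hamming x y ≡ 0 → x ≡ y
hamming≡0⇒≡ []      []      _  = refl
hamming≡0⇒≡ (a ∷ x) (b ∷ y) eq = cong₂ _∷_
  (bitDistance≡0⇒≡ a b (m+n≡0⇒m≡0 (bitDistance a b) eq))
  (hamming≡0⇒≡ x y (m+n≡0⇒n≡0 (bitDistance a b) eq))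

hamming-triangle : ∀ {n} (x y z : Vec Bool n) → hamming x z ≤ hamming x y + hamming y z
hamming-triangle []      []      []      = z≤n
hamming-triangle (a ∷ x) (b ∷ y) (c ∷ z) = begin
  bitDistance a c + hamming x z
    ≤⟨ +-mono-≤ (bitDistance-triangle a b c) (hamming-triangle x y z) ⟩
  (bitDistance a b + bitDistance b c) + (hamming x y + hamming y z)
    ≡⟨ interchange (bitDistance a b) (bitDistance b c) (hamming x y) (hamming y z) ⟩
  (bitDistance a b + hamming x y) + (bitDistance b c + hamming y z) ∎
  where open ≤-Reasoning

lookup-extensionality : ∀ {A : Set} {n} (x y : Vec A n) → (∀ j → lookup x j ≡ lookup y j) → x ≡ y
lookup-extensionality x y eq = begin
  x                   ≡⟨ tabulate∘lookup x ⟨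
  tabulate (lookup x) ≡⟨ tabulate-cong eq ⟩
  tabulate (lookup y) ≡⟨ tabulate∘lookup y ⟩
  y                   ∎
  where open ≡-Reasoning

QAdj⇒hamming≤1 : ∀ {n} (x y : QVertex n) → QAdj x y → hamming x y ≤ 1
QAdj⇒hamming≤1 x y (i , _ , agree) = agreeOutside⇒hamming≤1 x y i agree
  where
  agreeOutside⇒hamming≤1 : ∀ {n} (x y : QVertex n) (i : Fin n) →
    (∀ j → j ≢ i → lookup x j ≡ lookup y j) → hamming x y ≤ 1
  agreeOutside⇒hamming≤1 (a ∷ x) (b ∷ y) Fin.zero agree
    rewrite lookup-extensionality x y (λ j → agree (Fin.suc j) λ ())
          | hamming-self y
          | +-identityʳ (bitDistance a b) = bitDistance≤1 a b
  agreeOutside⇒hamming≤1 (a ∷ x) (b ∷ y) (Fin.suc i) agree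
    rewrite agree Fin.zero (λ ()) | bitDistance-self b =
      agreeOutside⇒hamming≤1 x y i λ j j≢i → agree (Fin.suc j) λ { refl → j≢i refl }

hamming≤walkLength : ∀ {n} {x y : QVertex n} {ℓ} → Walk x y ℓ → hamming x y ≤ ℓ
hamming≤walkLength [ x ] = ≤-reflexive (hamming-self x)
hamming≤walkLength {x = x} {y} (_∷_ {y = z} x~z w) = begin
  hamming x y               ≤⟨ hamming-triangle x z y ⟩
  hamming x z + hamming z y ≤⟨ +-mono-≤ (QAdj⇒hamming≤1 x z x~z) (hamming≤walkLength w) ⟩
  suc _                     ∎
  where open ≤-Reasoning

sphere : ∀ {n} → Vec Bool n → ℕ → List (Vec Bool n)
sphere []      zero    = [] ∷ []
sphere []      (suc i) = []
sphere (b ∷ x) zero    = map (b ∷_) (sphere x zero)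
sphere (b ∷ x) (suc i) = map (b ∷_) (sphere x (suc i)) ++ map (not b ∷_) (sphere x i)

length-sphere : ∀ {n} (x : Vec Bool n) i → length (sphere x i) ≡ n C i
length-sphere []      zero    = refl
length-sphere []      (suc i) = refl
length-sphere (b ∷ x) zero    = trans (length-map (b ∷_) (sphere x zero)) (length-sphere x zero)
length-sphere {suc n} (b ∷ x) (suc i) = begin
  length (map (b ∷_) (sphere x (suc i)) ++ map (not b ∷_) (sphere x i))
    ≡⟨ length-++ (map (b ∷_) (sphere x (suc i))) ⟩
  length (map (b ∷_) (sphere x (suc i))) + length (map (not b ∷_) (sphere x i))
    ≡⟨ cong₂ _+_ (length-map (b ∷_) (sphere x (suc i))) (length-map (not b ∷_) (sphere x i)) ⟩
  length (sphere x (suc i)) + length (sphere x i)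
    ≡⟨ cong₂ _+_ (length-sphere x (suc i)) (length-sphere x i) ⟩
  n C suc i + n C i
    ≡⟨ +-comm (n C suc i) (n C i) ⟩
  n C i + n C suc i
    ≡⟨ nCk+nC[k+1]≡[n+1]C[k+1] n i ⟩
  suc n C suc i ∎
  where open ≡-Reasoning

∈-sphere-∷ : ∀ {n} b (x : Vec Bool n) i {y} → y ∈ sphere x i → b ∷ y ∈ sphere (b ∷ x) i
∈-sphere-∷ b x zero    y∈ = ∈-map⁺ (b ∷_) y∈
∈-sphere-∷ b x (suc i) y∈ = ∈-++⁺ˡ (∈-map⁺ (b ∷_) y∈)

∈-sphere-∷-not : ∀ {n} b (x : Vec Bool n) i {y} →
  y ∈ sphere x i → not b ∷ y ∈ sphere (b ∷ x) (suc i)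
∈-sphere-∷-not b x i y∈ = ∈-++⁺ʳ _ (∈-map⁺ (not b ∷_) y∈)

∈-sphere : ∀ {n} (x y : Vec Bool n) → y ∈ sphere x (hamming x y)
∈-sphere []          []          = here refl
∈-sphere (false ∷ x) (false ∷ y) = ∈-sphere-∷ false x (hamming x y) (∈-sphere x y)
∈-sphere (true  ∷ x) (true  ∷ y) = ∈-sphere-∷ true x (hamming x y) (∈-sphere x y)
∈-sphere (false ∷ x) (true  ∷ y) = ∈-sphere-∷-not false x (hamming x y) (∈-sphere x y)
∈-sphere (true  ∷ x) (false ∷ y) = ∈-sphere-∷-not true x (hamming x y) (∈-sphere x y)

puncturedBall : ∀ {n} → Vec Bool n → ℕ → List (Vec Bool n)
puncturedBall x zero    = []
puncturedBall x (suc m) = puncturedBall x m ++ sphere x (suc m)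

length-puncturedBall : ∀ {n} (x : Vec Bool n) m → length (puncturedBall x m) ≡ binomSum n m
length-puncturedBall x zero    = refl
length-puncturedBall x (suc m) = trans (length-++ (puncturedBall x m))
  (cong₂ _+_ (length-puncturedBall x m) (length-sphere x (suc m)))

∈-puncturedBall : ∀ {n} (x y : Vec Bool n) m → 1 ≤ hamming x y → hamming x y ≤ m →
  y ∈ puncturedBall x m
∈-puncturedBall x y zero    1≤d d≤0 = contradiction (≤-trans 1≤d d≤0) λ ()
∈-puncturedBall x y (suc m) 1≤d d≤m+1 with m≤n⇒m<n∨m≡n d≤m+1
... | inj₁ d≤m = ∈-++⁺ˡ (∈-puncturedBall x y m 1≤d (s≤s⁻¹ d≤m))
... | inj₂ d≡m+1 = ∈-++⁺ʳ (puncturedBall x m) (subst (λ i → y ∈ sphere x i) d≡m+1 (∈-sphere x y))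

∈-─ : ∀ {A : Set} {x z : A} {ys : List A} (x∈ys : x ∈ ys) → z ∈ ys → z ≢ x → z ∈ (ys ─ x∈ys)
∈-─ (here refl) (here refl) z≢x = contradiction refl z≢x
∈-─ (here _)    (there z∈ys) _  = z∈ys
∈-─ (there _)   (here z≡y)   _  = here z≡y
∈-─ (there x∈ys) (there z∈ys) z≢x = there (∈-─ x∈ys z∈ys z≢x)

Unique-⊆⇒length≤ : ∀ {A : Set} {xs ys : List A} → Unique xs → xs ⊆ ys → length xs ≤ length ys
Unique-⊆⇒length≤ {xs = []}     _                 _  = z≤n
Unique-⊆⇒length≤ {xs = x ∷ xs} {ys} (x∉xs ∷ uniq) xs⊆ys = begin
  suc (length xs)          ≤⟨ s≤s (Unique-⊆⇒length≤ uniq xs⊆ys─x) ⟩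
  suc (length (ys ─ x∈ys)) ≡⟨ length-removeAt′ ys (Any.index x∈ys) ⟨
  length ys                ∎
  where
  open ≤-Reasoning
  x∈ys : x ∈ ys
  x∈ys = xs⊆ys (here refl)
  xs⊆ys─x : xs ⊆ (ys ─ x∈ys)
  xs⊆ys─x z∈xs = ∈-─ x∈ys (xs⊆ys (there z∈xs)) (≢-sym (All.lookup x∉xs z∈xs))

∈⇒≤-foldr-⊔ : ∀ {y} ys → y ∈ ys → y ≤ foldr _⊔_ 0 ys
∈⇒≤-foldr-⊔ {y} ys y∈ys = foldr-preservesᵒ {P = y ≤_} ≤-⊔ 0 ys (inj₂ (Any.map ≤-reflexive y∈ys))
  where
  ≤-⊔ : ∀ a b → y ≤ a ⊎ y ≤ b → y ≤ a ⊔ b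
  ≤-⊔ a b (inj₁ y≤a) = m≤n⇒m≤n⊔o b y≤a
  ≤-⊔ a b (inj₂ y≤b) = m≤n⇒m≤o⊔n a y≤b

<-foldr-⊔⇒Any : ∀ {a} xs → a < foldr _⊔_ 0 xs → Any (a <_) xs
<-foldr-⊔⇒Any {a} xs a<max with foldr-selective ⊔-sel 0 xs
... | inj₁ max≡0   = contradiction (subst (a <_) max≡0 a<max) n≮0
... | inj₂ max∈xs = Any.map (λ max≡x → subst (a <_) max≡x a<max) max∈xs

module _ {N : ℕ} (G : Graph N) where
  open Graph G using (adj?)

  neighbours : Fin N → List (Fin N)
  neighbours v = filter (adj? v) (allFin N)

  <-maxDegree⇒∃ : ∀ {a} → a < maxDegree G → ∃ λ v → a < degree G v
  <-maxDegree⇒∃ a<Δ = Any.satisfied (map⁻ (<-foldr-⊔⇒Any (map (degree G) (allFin N)) a<Δ))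

module _ {N n : ℕ} {G : Graph N} (e : Embedding G n) where
  open Graph G using (Adj; adj?; irrefl)
  open Embedding e

  pairLength≤dilation : ∀ u v → pairLength u v ≤ dilation
  pairLength≤dilation u v = ∈⇒≤-foldr-⊔ _
    (∈-concat⁺′ (∈-map⁺ (pairLength u) (∈-allFin v))
                (∈-map⁺ (λ w → map (pairLength w) (allFin N)) (∈-allFin u)))

  hamming≤pairLength : ∀ {u v} → Adj u v → hamming (f u) (f v) ≤ pairLength u v
  hamming≤pairLength {u} {v} uv with adj? u v
  ... | yes uv′ = hamming≤walkLength (proj₁ (proj₂ (P u v uv′)))
  ... | no ¬uv  = contradiction uv ¬uv

  1≤hamming-edge : ∀ {u v} → Adj u v → 1 ≤ hamming (f u) (f v)
  1≤hamming-edge {u} uv = n≢0⇒n>0 λ d≡0 →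
    irrefl (subst (Adj u) (sym (f-inj (hamming≡0⇒≡ (f u) _ d≡0))) uv)

  neighbourImages⊆puncturedBall : ∀ {m} → dilation ≤ m → ∀ v →
    map f (neighbours G v) ⊆ puncturedBall (f v) m
  neighbourImages⊆puncturedBall {m} dil≤m v fu∈ with ∈-map⁻ f fu∈
  ... | u , u∈ , refl = ∈-puncturedBall (f v) (f u) m (1≤hamming-edge vu)
    (≤-trans (hamming≤pairLength vu) (≤-trans (pairLength≤dilation v u) dil≤m))
    where
    vu : Adj v u
    vu = proj₂ (∈-filter⁻ (adj? v) {xs = allFin N} u∈)

  degree≤binomSum : ∀ {m} → dilation ≤ m → ∀ v → degree G v ≤ binomSum n m
  degree≤binomSum {m} dil≤m v = begin
    degree G v                          ≡⟨ length-map f (neighbours G v) ⟨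
    length (map f (neighbours G v))     ≤⟨ Unique-⊆⇒length≤ unique (neighbourImages⊆puncturedBall dil≤m v) ⟩
    length (puncturedBall (f v) m)      ≡⟨ length-puncturedBall (f v) m ⟩
    binomSum n m                        ∎
    where
    open ≤-Reasoning
    unique : Unique (map f (neighbours G v))
    unique = Unique.map⁺ f-inj (Unique.filter⁺ (adj? v) (Unique.allFin⁺ N))

lemma3p2 : (n : ℕ) → 1 ≤ n → (G : Graph (2 ^ n)) →
    (k : ℕ) → 0 < k → binomSum n (k ∸ 1) < maxDegree G →
    DilAtLeast G n k
lemma3p2 n _ G zero    ()
lemma3p2 n _ G (suc m) _  Σ<Δ e = ≮⇒≥ λ dil<k →
  let v , Σ<deg = <-maxDegree⇒∃ G Σ<Δ
  in <⇒≱ Σ<deg (degree≤binomSum e (s≤s⁻¹ dil<k) v)
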